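{- Let $G$ be a graph and $S\subseteq V(G)$. For any nonempty set $C\subseteq V(G)$ such that $G[C]$ is connected, the following are equivalent: (i) $N(C)$ is an important $C$–$S$ separator; (ii) for every $v\in C$, $N(C)$ is an important $\{v\}$–$S$ separator; (iii) there exists $v\in C$ such that $N(C)$ is an important $\{v\}$–$S$ separator.
   Context: $N(C)$ denotes the set of vertices outside $C$ adjacent to some vertex of $C$. For $X,Y\subseteq V(G)$, a set $W\subseteq V(G)$ is an $X$–$Y$ separator if no connected component of $G\setminus W$ contains both a vertex of $X$ and a vertex of $Y$. For a graph $H$ and $A\subseteq V(H)$, $R_H(A)$ is the set of vertices reachable from $A$ in $H$. An inclusion-wise minimal $X$–$Y$ separator $W$ is important if there is no $X$–$Y$ separator $W'$ with $|W'|\le|W|$ and $R_{G\setminus W}(X\setminus W)\subsetneq R_{G\setminus W'}(X\setminus W')$. -}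

module Defs where

open import Data.Nat using (ℕ; _≤_)
open import Data.Fin using (Fin)
open import Data.Fin.Properties using (any?)
open import Data.Fin.Subset using (Subset; _∈_; _∉_; _⊆_; ∣_∣; ⁅_⁆; ∁)
open import Data.Fin.Subset.Properties using (_∈?_)
open import Data.Vec using (tabulate)
open import Data.Product using (_×_; ∃; Σ; _,_)
open import Relation.Nullary using (¬_; Dec)
open import Relation.Nullary.Decidable using (⌊_⌋; _×-dec_; ¬?)
open import Relation.Binary.PropositionalEquality using (_≡_; _≢_)

record Graph (n : ℕ) : Set₁ where
  field
    Adj     : Fin n → Fin n → Set
    adj?    : ∀ u v → Dec (Adj u v)
    sym     : ∀ {u v} → Adj u v → Adj v u
    irrefl  : ∀ {u} → ¬ Adj u u
open Graph public

module _ {n : ℕ} (G : Graph n) where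

  data Reach (W A : Subset n) : Fin n → Set where
    start : ∀ {x} → x ∈ A → x ∉ W → Reach W A x
    step  : ∀ {x y} → Reach W A x → Adj G x y → y ∉ W → Reach W A y

  N : Subset n → Subset n
  N C = tabulate λ v → ⌊ ¬? (v ∈? C) ×-dec any? (λ u → (u ∈? C) ×-dec adj? G u v) ⌋

  Connected : Subset n → Set
  Connected C = ∀ {u v} → u ∈ C → v ∈ C → Reach (∁ C) ⁅ u ⁆ v

  IsSeparator : Subset n → Subset n → Subset n → Set
  IsSeparator X Y W = ∀ {y} → y ∈ Y → ¬ Reach W X y

  IsMinimalSeparator : Subset n → Subset n → Subset n → Set
  IsMinimalSeparator X Y W =
    IsSeparator X Y W × (∀ W' → W' ⊆ W → W' ≢ W → ¬ IsSeparator X Y W')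

  ReachStrict : Subset n → Subset n → Subset n → Set
  ReachStrict X W W' =
    (∀ {y} → Reach W X y → Reach W' X y) × ∃ λ y → Reach W' X y × ¬ Reach W X y

  IsImportant : Subset n → Subset n → Subset n → Set
  IsImportant X Y W =
    IsMinimalSeparator X Y W ×
    (∀ W' → IsSeparator X Y W' → ∣ W' ∣ ≤ ∣ W ∣ → ¬ ReachStrict X W W')

-- Every separator W that matters avoids C: N(C) does, its subsets do, and a W' whose
-- reachable set contains that of N(C) contains C ⊆ R_{G∖N(C)}(C) and so misses C.  For
-- such W, connectivity of G[C] makes R_{G∖W}(C) = R_{G∖W}({v}) for any v ∈ C, so
-- separation, minimality and importance of N(C) read the same for the sources C and {v}.
module Submission where

open import Defs
open import Data.Nat using (ℕ; _≤_)
open import Data.Fin using (Fin)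
open import Data.Fin.Subset using (Subset; _∈_; _∉_; _⊆_; ∣_∣; ⁅_⁆; Nonempty)
open import Data.Fin.Subset.Properties using (x∈⁅y⁆⇒x≡y; x∉∁p⇒x∈p)
open import Data.Vec.Properties using ([]=⇒lookup; lookup∘tabulate)
open import Data.Bool.Properties using (T-≡)
open import Data.Product using (_×_; ∃; _,_; proj₁)
open import Function.Bundles using (_⇔_; mk⇔; Equivalence)
open import Relation.Nullary using (¬_)
open import Relation.Nullary.Decidable using (toWitness)
open import Relation.Binary.PropositionalEquality using (_≢_; trans; subst) renaming (sym to ≡-sym)

x∈p⇒⁅x⁆⊆p : ∀ {n} {x : Fin n} {p : Subset n} → x ∈ p → ⁅ x ⁆ ⊆ p
x∈p⇒⁅x⁆⊆p {x = x} {p} x∈p y∈⁅x⁆ = subst (_∈ p) (≡-sym (x∈⁅y⁆⇒x≡y x y∈⁅x⁆)) x∈p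

module _ {n : ℕ} (G : Graph n) where

  Avoids : Subset n → Subset n → Set
  Avoids C W = ∀ {x} → x ∈ C → x ∉ W

  SameReach : Subset n → Subset n → Subset n → Set
  SameReach W X X' = ∀ {y} → Reach G W X y ⇔ Reach G W X' y

  ReachCovers : Subset n → Subset n → Subset n → Set
  ReachCovers W X C = ∀ {x} → x ∈ C → Reach G W X x

  Reach⇒∉ : ∀ {W A y} → Reach G W A y → y ∉ W
  Reach⇒∉ (start _ y∉W) = y∉W
  Reach⇒∉ (step _ _ y∉W) = y∉W

  Reach-mono-∉ : ∀ {W W' A y} → (∀ {z} → z ∉ W → z ∉ W') → Reach G W A y → Reach G W' A y
  Reach-mono-∉ f (start a z∉W) = start a (f z∉W)
  Reach-mono-∉ f (step r e z∉W) = step (Reach-mono-∉ f r) e (f z∉W)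

  Reach-mono-source : ∀ {W A B y} → A ⊆ B → Reach G W A y → Reach G W B y
  Reach-mono-source A⊆B (start a z∉W) = start (A⊆B a) z∉W
  Reach-mono-source A⊆B (step r e z∉W) = step (Reach-mono-source A⊆B r) e z∉W

  Avoids-⊆ : ∀ {C W W'} → W' ⊆ W → Avoids C W → Avoids C W'
  Avoids-⊆ W'⊆W avoids x∈C x∈W' = avoids x∈C (W'⊆W x∈W')

  reach-⊆⇒Avoids : ∀ {C X W W'} → ReachCovers W X C →
    (∀ {y} → Reach G W X y → Reach G W' X y) → Avoids C W'
  reach-⊆⇒Avoids covers incl x∈C = Reach⇒∉ (incl (covers x∈C))

  N-Avoids : ∀ C → Avoids C (N G C)
  N-Avoids C {x} x∈C x∈N =
    proj₁ (toWitness (Equivalence.from T-≡ (trans (≡-sym (lookup∘tabulate _ x)) ([]=⇒lookup x∈N)))) x∈C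

  SameReach-sym : ∀ {W X X'} → SameReach W X X' → SameReach W X' X
  SameReach-sym same = mk⇔ (Equivalence.from same) (Equivalence.to same)

  IsSeparator-transfer : ∀ {X X' Y W} → SameReach W X X' → IsSeparator G X Y W → IsSeparator G X' Y W
  IsSeparator-transfer same sep y∈Y r = sep y∈Y (Equivalence.from same r)

  IsImportant-transfer : ∀ {C X X' Y W} → (∀ {W'} → Avoids C W' → SameReach W' X X') →
    Avoids C W → ReachCovers W X' C → IsImportant G X Y W → IsImportant G X' Y W
  IsImportant-transfer {C} {X} {X'} {Y} {W} same avoids covers ((sep , minimal) , important) =
    (IsSeparator-transfer (same avoids) sep , minimal') , important'
    where
    minimal' : ∀ W' → W' ⊆ W → W' ≢ W → ¬ IsSeparator G X' Y W'
    minimal' W' W'⊆W W'≢W sep' =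
      minimal W' W'⊆W W'≢W (IsSeparator-transfer (SameReach-sym (same (Avoids-⊆ W'⊆W avoids))) sep')

    important' : ∀ W' → IsSeparator G X' Y W' → ∣ W' ∣ ≤ ∣ W ∣ → ¬ ReachStrict G X' W W'
    important' W' sep' size (incl , y , r' , ¬r) =
      important W' (IsSeparator-transfer (SameReach-sym same') sep') size
        ( (λ r → from' (incl (to r)))
        , y , from' r' , λ r → ¬r (to r))
      where
      to : ∀ {z} → Reach G W X z → Reach G W X' z
      to = Equivalence.to (same avoids)

      same' : SameReach W' X X'
      same' = same (reach-⊆⇒Avoids covers incl)

      from' : ∀ {z} → Reach G W' X' z → Reach G W' X z
      from' = Equivalence.from same'

  module _ {C : Subset n} (connected : Connected G C) where

    SameReach-connected : ∀ {W v} → v ∈ C → Avoids C W → SameReach W C ⁅ v ⁆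
    SameReach-connected {W} {v} v∈C avoids = mk⇔ toSingleton (Reach-mono-source (x∈p⇒⁅x⁆⊆p v∈C))
      where
      toSingleton : ∀ {y} → Reach G W C y → Reach G W ⁅ v ⁆ y
      toSingleton (start x∈C _) = Reach-mono-∉ (λ z∉∁C → avoids (x∉∁p⇒x∈p z∉∁C)) (connected v∈C x∈C)
      toSingleton (step r e y∉W) = step (toSingleton r) e y∉W

    ReachCovers-N : ∀ {v} → v ∈ C → ReachCovers (N G C) ⁅ v ⁆ C
    ReachCovers-N v∈C x∈C = Equivalence.to (SameReach-connected v∈C (N-Avoids C)) (start x∈C (N-Avoids C x∈C))

    IsImportant-N⇔ : ∀ {S v} → v ∈ C → IsImportant G C S (N G C) ⇔ IsImportant G ⁅ v ⁆ S (N G C)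
    IsImportant-N⇔ v∈C = mk⇔
      (IsImportant-transfer (SameReach-connected v∈C) (N-Avoids C) (ReachCovers-N v∈C))
      (IsImportant-transfer (λ avoids → SameReach-sym (SameReach-connected v∈C avoids))
        (N-Avoids C) (λ x∈C → start x∈C (N-Avoids C x∈C)))

lemma3 : {n : ℕ} (G : Graph n) (S C : Subset n) →
    Nonempty C → Connected G C →
    (IsImportant G C S (N G C) ⇔ (∀ v → v ∈ C → IsImportant G ⁅ v ⁆ S (N G C)))
    × ((∀ v → v ∈ C → IsImportant G ⁅ v ⁆ S (N G C)) ⇔ (∃ λ v → v ∈ C × IsImportant G ⁅ v ⁆ S (N G C)))
lemma3 G S C (u , u∈C) connected =
  mk⇔ (λ i v v∈C → to (at v∈C) i) (λ ii → from (at u∈C) (ii u u∈C)) ,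
  mk⇔ (λ ii → u , u∈C , ii u u∈C)
      (λ { (w , w∈C , iii) v v∈C → to (at v∈C) (from (at w∈C) iii) })
  where
  open Equivalence
  at : ∀ {v} → v ∈ C → IsImportant G C S (N G C) ⇔ IsImportant G ⁅ v ⁆ S (N G C)
  at = IsImportant-N⇔ G connected
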